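{- Let $(\mathscr{A},\preccurlyeq,\to)$ be an implicative structure. Given a separator $S\subseteq\mathscr{A}$, the following are equivalent: (1) $S$ is finitely generated and ${\pitchfork}^{\mathscr{A}}\in S$. (2) $S$ is a principal filter of $\mathscr{A}$: $S={\uparrow}\{\Theta\}$ for some $\Theta\in S$. (3) The induced Heyting algebra $(\mathscr{A}/S,\le_S)$ is complete and the canonical surjection $[\,\cdot\,]_{/S}:\mathscr{A}\to\mathscr{A}/S$ commutes with arbitrary meets: $\bigl[\bigwedge_{i\in I}a_i\bigr]_{/S}=\bigwedge_{i\in I}[a_i]_{/S}$ for all families $(a_i)_{i\in I}\in\mathscr{A}^I$.
   Context: An implicative structure is a complete lattice $(\mathscr{A},\preccurlyeq)$ (meets $\bigwedge$, binary meet $\wedge$) with $\to$ anti-monotonic in its first and monotonic in its second argument, commuting with arbitrary meets in its second argument. Application is $ab=\bigwedge\{c:a\preccurlyeq(b\to c)\}$, abstraction of $f:\mathscr{A}\to\mathscr{A}$ is $\bigwedge_a(a\to f(a))$, and closed $\lambda$-terms with parameters are interpreted as $t^{\mathscr{A}}$ accordingly. A separator is an upwards closed $S\subseteq\mathscr{A}$ containing $\mathbf{K}^{\mathscr{A}}=(\lambda xy.x)^{\mathscr{A}}$ and $\mathbf{S}^{\mathscr{A}}=(\lambda xyz.xz(yz))^{\mathscr{A}}$ and closed under modus ponens. $S$ is finitely generated if it is the smallest separator containing some finite $X\subseteq\mathscr{A}$. ${\pitchfork}^{\mathscr{A}}=(\lambda xy.x)^{\mathscr{A}}\wedge(\lambda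 xy.y)^{\mathscr{A}}=\bigwedge_{a,b}(a\to b\to a\wedge b)$. $(\mathscr{A}/S,\le_S)$ is the poset reflection of the preorder $a\vdash_S b$ iff $(a\to b)\in S$; it is a Heyting algebra. ${\uparrow}\{\Theta\}=\{a:\Theta\preccurlyeq a\}$. -}

module Defs where

open import Level using (Level; suc; _⊔_)
open import Data.Product using (Σ; _×_; _,_)
open import Data.Sum using (_⊎_)
open import Data.List using (List)
open import Data.List.Membership.Propositional using (_∈_)
open import Relation.Binary.Core using (Rel)
open import Relation.Binary.Structures using (IsPartialOrder)
open import Relation.Binary.PropositionalEquality using (_≡_)

record ImplicativeStructure (ℓ : Level) : Set (suc ℓ) where
  infix 4 _≼_
  infixr 6 _⇒_
  field
    Carrier        : Set ℓ
    _≼_            : Rel Carrier ℓ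
    isPartialOrder : IsPartialOrder _≡_ _≼_
    ⋀              : (Carrier → Set ℓ) → Carrier
    ⋀-lower        : ∀ {P : Carrier → Set ℓ} {a} → P a → ⋀ P ≼ a
    ⋀-greatest     : ∀ {P : Carrier → Set ℓ} {c} → (∀ {a} → P a → c ≼ a) → c ≼ ⋀ P
    _⇒_            : Carrier → Carrier → Carrier
    ⇒-mono         : ∀ {a a′ b b′} → a′ ≼ a → b ≼ b′ → (a ⇒ b) ≼ (a′ ⇒ b′)
    ⇒-⋀            : ∀ (a : Carrier) (P : Carrier → Set ℓ) →
                     (a ⇒ ⋀ P) ≡ ⋀ (λ c → Σ Carrier λ b → P b × c ≡ (a ⇒ b))

module ImplicativeStructureDefs {ℓ : Level} (𝒜 : ImplicativeStructure ℓ) where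
  open ImplicativeStructure 𝒜

  _∧_ : Carrier → Carrier → Carrier
  a ∧ b = ⋀ (λ x → x ≡ a ⊎ x ≡ b)

  ⋀ᶠ : {I : Set ℓ} → (I → Carrier) → Carrier
  ⋀ᶠ {I} f = ⋀ (λ x → Σ I λ i → f i ≡ x)

  app : Carrier → Carrier → Carrier
  app a b = ⋀ (λ c → a ≼ (b ⇒ c))

  lam : (Carrier → Carrier) → Carrier
  lam f = ⋀ᶠ (λ a → a ⇒ f a)

  𝐊 : Carrier
  𝐊 = lam (λ x → lam (λ y → x))

  𝐒 : Carrier
  𝐒 = lam (λ x → lam (λ y → lam (λ z → app (app x z) (app y z))))

  𝐊′ : Carrier
  𝐊′ = lam (λ x → lam (λ y → y))

  ⋔ : Carrier
  ⋔ = 𝐊 ∧ 𝐊′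

  record IsSeparator (S : Carrier → Set ℓ) : Set ℓ where
    field
      upClosed : ∀ {a b} → S a → a ≼ b → S b
      K∈S      : S 𝐊
      S∈S      : S 𝐒
      mp       : ∀ {a b} → S (a ⇒ b) → S a → S b

  GeneratedBy : (Carrier → Set ℓ) → List Carrier → Set (suc ℓ)
  GeneratedBy S X =
    IsSeparator S × (∀ {x} → x ∈ X → S x) ×
    (∀ (S′ : Carrier → Set ℓ) → IsSeparator S′ → (∀ {x} → x ∈ X → S′ x) →
       ∀ {a} → S a → S′ a)

  FinitelyGenerated : (Carrier → Set ℓ) → Set (suc ℓ)
  FinitelyGenerated S = Σ (List Carrier) λ X → GeneratedBy S X

  PrincipalFilter : (Carrier → Set ℓ) → Set ℓ
  PrincipalFilter S =
    Σ Carrier λ Θ → S Θ × (∀ a → (S a → Θ ≼ a) × (Θ ≼ a → S a))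

  -- The poset reflection
  -- 𝒜/S is represented as a setoid: [a] ≤_S [b] iff a ⊢_S b, and a family
  -- of elements of 𝒜/S is a family of representatives in 𝒜.
  _⊢[_]_ : Carrier → (Carrier → Set ℓ) → Carrier → Set ℓ
  a ⊢[ S ] b = S (a ⇒ b)

  IsGlbᶠ : (S : Carrier → Set ℓ) {I : Set ℓ} → (I → Carrier) → Carrier → Set ℓ
  IsGlbᶠ S {I} f m =
    (∀ i → m ⊢[ S ] f i) × (∀ c → (∀ i → c ⊢[ S ] f i) → c ⊢[ S ] m)

  QuotientComplete : (Carrier → Set ℓ) → Set (suc ℓ)
  QuotientComplete S = ∀ (I : Set ℓ) (f : I → Carrier) → Σ Carrier λ m → IsGlbᶠ S f m

  ClassMapCommutesWithMeets : (Carrier → Set ℓ) → Set (suc ℓ)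
  ClassMapCommutesWithMeets S = ∀ (I : Set ℓ) (f : I → Carrier) → IsGlbᶠ S f (⋀ᶠ f)

module Submission where

-- (2 ⇔ 3) If S = ↑Θ then Θ ≼ c ⇒ a_i for all i forces Θ ≼ c ⇒ ⋀ a_i, since
--   ⇒ commutes with meets; conversely, if the class map preserves meets,
--   then the meet Θ of S itself satisfies 𝐊 ⊢_S Θ, hence Θ ∈ S.
-- (2 ⇒ 1) ↑Θ is generated by Θ, and 𝐊, 𝐊′ ≽ Θ gives ⋔ ≽ Θ.
-- (1 ⇒ 2) With ⋔ ∈ S, S is closed under binary meets, so the meet g of the
--   generators and of 𝐊, 𝐒 lies in S.  A Turing-style fixed point yields
--   Θ ∈ S with Θ ≼ ⋔ g (Θ Θ) ≼ g ∧ Θ Θ; such a Θ makes ↑Θ a separator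
--   containing the generators, so S ⊆ ↑Θ by minimality.

open import Defs
open import Level using (Level)
open import Data.Product using (_×_; Σ; _,_; proj₁; proj₂)
open import Data.Sum using (inj₁; inj₂)
open import Data.List using (List; []; _∷_)
open import Data.List.Relation.Unary.Any using (here; there)
open import Data.List.Membership.Propositional using (_∈_)
open import Function.Bundles using (_⇔_; mk⇔)
open import Relation.Binary.PropositionalEquality using (refl; sym; subst)
open import Relation.Binary.Structures using (IsPartialOrder)

module Calculus {ℓ : Level} (𝒜 : ImplicativeStructure ℓ) where
  open ImplicativeStructure 𝒜
  open ImplicativeStructureDefs 𝒜
  open IsPartialOrder isPartialOrder using (reflexive; trans)

  infixl 9 _∙_
  _∙_ : Carrier → Carrier → Carrier
  _∙_ = app

  ≼-refl : ∀ {a} → a ≼ a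
  ≼-refl = reflexive refl

  ⋀ᶠ-lower : ∀ {I : Set ℓ} {f : I → Carrier} i → ⋀ᶠ f ≼ f i
  ⋀ᶠ-lower i = ⋀-lower (i , refl)

  ⋀ᶠ-greatest : ∀ {I : Set ℓ} {f : I → Carrier} {c} → (∀ i → c ≼ f i) → c ≼ ⋀ᶠ f
  ⋀ᶠ-greatest h = ⋀-greatest λ { (i , refl) → h i }

  ∧-lowerˡ : ∀ {a b} → a ∧ b ≼ a
  ∧-lowerˡ = ⋀-lower (inj₁ refl)

  ∧-lowerʳ : ∀ {a b} → a ∧ b ≼ b
  ∧-lowerʳ = ⋀-lower (inj₂ refl)

  ∧-greatest : ∀ {a b c} → c ≼ a → c ≼ b → c ≼ a ∧ b
  ∧-greatest h₁ h₂ = ⋀-greatest λ { (inj₁ refl) → h₁ ; (inj₂ refl) → h₂ }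

  -- Since ⇒ commutes with meets in its second argument, a common lower
  -- bound of the c ⇒ f i is below c ⇒ ⋀ f.
  ⇒-⋀ᶠ-greatest : ∀ {I : Set ℓ} {f : I → Carrier} {c d} →
                  (∀ i → d ≼ c ⇒ f i) → d ≼ c ⇒ ⋀ᶠ f
  ⇒-⋀ᶠ-greatest {c = c} {d} h =
    subst (d ≼_) (sym (⇒-⋀ c _)) (⋀-greatest λ { (_ , (i , refl) , refl) → h i })

  ∙-elim : ∀ {a b c} → c ≼ a ⇒ b → c ∙ a ≼ b
  ∙-elim h = ⋀-lower h

  ∙-unit : ∀ {a c} → c ≼ a ⇒ c ∙ a
  ∙-unit {a} {c} = subst (c ≼_) (sym (⇒-⋀ a (λ b → c ≼ a ⇒ b)))
    (⋀-greatest λ { (_ , h , refl) → h })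

  ⇒-intro : ∀ {a b c} → c ∙ a ≼ b → c ≼ a ⇒ b
  ⇒-intro h = trans ∙-unit (⇒-mono ≼-refl h)

  ∙-mono : ∀ {a a′ b b′} → a ≼ a′ → b ≼ b′ → a ∙ b ≼ a′ ∙ b′
  ∙-mono ha hb = ⋀-greatest λ h → ⋀-lower (trans ha (trans h (⇒-mono hb ≼-refl)))

  ∙-monoˡ : ∀ {a a′ b} → a ≼ a′ → a ∙ b ≼ a′ ∙ b
  ∙-monoˡ h = ∙-mono h ≼-refl

  lam-β : ∀ {f a} → lam f ∙ a ≼ f a
  lam-β {a = a} = ∙-elim (⋀ᶠ-lower a)

  lam-intro : ∀ {f c} → (∀ a → c ∙ a ≼ f a) → c ≼ lam f
  lam-intro h = ⋀ᶠ-greatest λ a → ⇒-intro (h a)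

  𝐊-β : ∀ {a b} → 𝐊 ∙ a ∙ b ≼ a
  𝐊-β = trans (∙-monoˡ lam-β) lam-β

  𝐊′-β : ∀ {a b} → 𝐊′ ∙ a ∙ b ≼ b
  𝐊′-β = trans (∙-monoˡ lam-β) lam-β

  𝐒-β : ∀ {a b c} → 𝐒 ∙ a ∙ b ∙ c ≼ a ∙ c ∙ (b ∙ c)
  𝐒-β = trans (∙-monoˡ (trans (∙-monoˡ lam-β) lam-β)) lam-β

  ⋔-β : ∀ {a b} → ⋔ ∙ a ∙ b ≼ a ∧ b
  ⋔-β = ∧-greatest (trans (∙-monoˡ (∙-monoˡ ∧-lowerˡ)) 𝐊-β)
                   (trans (∙-monoˡ (∙-monoˡ ∧-lowerʳ)) 𝐊′-β)

  𝐈 : Carrier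
  𝐈 = 𝐒 ∙ 𝐊 ∙ 𝐊

  𝐈-β : ∀ {a} → 𝐈 ∙ a ≼ a
  𝐈-β = trans 𝐒-β 𝐊-β

  𝐌 : Carrier
  𝐌 = 𝐒 ∙ 𝐈 ∙ 𝐈

  𝐌-β : ∀ {a} → 𝐌 ∙ a ≼ a ∙ a
  𝐌-β = trans 𝐒-β (∙-mono 𝐈-β 𝐈-β)

  -- If Θ lies below 𝐊, 𝐒 and its own self-application Θ Θ, then the
  -- principal filter ↑Θ is a separator (Θ Θ ≼ (a ⇒ b) a ≼ b gives modus ponens).
  ↑-isSeparator : ∀ {Θ} → Θ ≼ 𝐊 → Θ ≼ 𝐒 → Θ ≼ Θ ∙ Θ → IsSeparator (Θ ≼_)
  ↑-isSeparator Θ≼𝐊 Θ≼𝐒 Θ≼ΘΘ = record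
    { upClosed = trans
    ; K∈S      = Θ≼𝐊
    ; S∈S      = Θ≼𝐒
    ; mp       = λ h₁ h₂ → trans Θ≼ΘΘ (trans (∙-mono h₁ h₂) (∙-elim ≼-refl))
    }

  generatorMeet : List Carrier → Carrier
  generatorMeet []       = 𝐊 ∧ 𝐒
  generatorMeet (x ∷ xs) = x ∧ generatorMeet xs

  generatorMeet≼𝐊 : ∀ xs → generatorMeet xs ≼ 𝐊
  generatorMeet≼𝐊 []       = ∧-lowerˡ
  generatorMeet≼𝐊 (_ ∷ xs) = trans ∧-lowerʳ (generatorMeet≼𝐊 xs)

  generatorMeet≼𝐒 : ∀ xs → generatorMeet xs ≼ 𝐒
  generatorMeet≼𝐒 []       = ∧-lowerʳ
  generatorMeet≼𝐒 (_ ∷ xs) = trans ∧-lowerʳ (generatorMeet≼𝐒 xs)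

  generatorMeet≼∈ : ∀ xs {x} → x ∈ xs → generatorMeet xs ≼ x
  generatorMeet≼∈ (_ ∷ _)  (here refl) = ∧-lowerˡ
  generatorMeet≼∈ (_ ∷ xs) (there x∈)  = trans ∧-lowerʳ (generatorMeet≼∈ xs x∈)

  module InSeparator (S : Carrier → Set ℓ) (sep : IsSeparator S) where
    open IsSeparator sep

    ∙-closed : ∀ {a b} → S a → S b → S (a ∙ b)
    ∙-closed sa sb = mp (upClosed sa ∙-unit) sb

    𝐈∈S : S 𝐈
    𝐈∈S = ∙-closed (∙-closed S∈S K∈S) K∈S

    𝐌∈S : S 𝐌
    𝐌∈S = ∙-closed (∙-closed S∈S 𝐈∈S) 𝐈∈S

    -- The order entails S-entailment, witnessed by 𝐈.
    ≼⇒⊢ : ∀ {a b} → a ≼ b → a ⊢[ S ] b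
    ≼⇒⊢ h = upClosed 𝐈∈S (⇒-intro (trans 𝐈-β h))

    -- 𝐊′ ≽ 𝐊 𝐈, since 𝐊 𝐈 a b ≼ 𝐈 b ≼ b.
    𝐊′∈S : S 𝐊′
    𝐊′∈S = upClosed (∙-closed K∈S 𝐈∈S) (lam-intro λ _ → trans 𝐊-β (lam-intro λ _ → 𝐈-β))

    -- Every element of S is entailed by 𝐊, witnessed by 𝐊 a.
    𝐊⊢ : ∀ {a} → S a → 𝐊 ⊢[ S ] a
    𝐊⊢ sa = upClosed (∙-closed K∈S sa) (⇒-intro 𝐊-β)

    -- With ⋔ ∈ S, a separator is closed under binary meets (⋔ a b ≼ a ∧ b).
    ∧-closed : S ⋔ → ∀ {a b} → S a → S b → S (a ∧ b)
    ∧-closed s⋔ sa sb = upClosed (∙-closed (∙-closed s⋔ sa) sb) ⋔-β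

    generatorMeet∈S : S ⋔ → ∀ xs → (∀ {x} → x ∈ xs → S x) → S (generatorMeet xs)
    generatorMeet∈S s⋔ []       _  = ∧-closed s⋔ K∈S S∈S
    generatorMeet∈S s⋔ (x ∷ xs) xs⊆S =
      ∧-closed s⋔ (xs⊆S (here refl)) (generatorMeet∈S s⋔ xs λ x∈ → xs⊆S (there x∈))

    -- Turing-style fixed point: for h ∈ S, put t = 𝐒 (𝐊 h) (𝐒 𝐌 𝐌) and
    -- Θ = t t.  Then Θ ≼ 𝐊 h t (𝐌 t (𝐌 t)) ≼ h (t t (t t)) = h (Θ Θ).
    selfApplicationFixpoint : ∀ {h} → S h → Σ Carrier λ Θ → S Θ × Θ ≼ h ∙ (Θ ∙ Θ)
    selfApplicationFixpoint {h} sh = t ∙ t , ∙-closed st st , t-β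
      where
      t : Carrier
      t = 𝐒 ∙ (𝐊 ∙ h) ∙ (𝐒 ∙ 𝐌 ∙ 𝐌)

      st : S t
      st = ∙-closed (∙-closed S∈S (∙-closed K∈S sh)) (∙-closed (∙-closed S∈S 𝐌∈S) 𝐌∈S)

      t-β : ∀ {w} → t ∙ w ≼ h ∙ (w ∙ w ∙ (w ∙ w))
      t-β = trans 𝐒-β (∙-mono 𝐊-β (trans 𝐒-β (∙-mono 𝐌-β 𝐌-β)))

    principal⇒commutes : PrincipalFilter S → ClassMapCommutesWithMeets S
    principal⇒commutes (Θ , _ , ↑Θ) I f =
      (λ i → ≼⇒⊢ (⋀ᶠ-lower i)) ,
      λ c c⊢f → proj₂ (↑Θ _) (⇒-⋀ᶠ-greatest λ i → proj₁ (↑Θ _) (c⊢f i))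

    commutes⇒complete : ClassMapCommutesWithMeets S → QuotientComplete S
    commutes⇒complete commutes I f = ⋀ᶠ f , commutes I f

    -- (3) ⇒ (2): the meet Θ of S satisfies 𝐊 ⊢_S Θ, so Θ ∈ S and S = ↑Θ.
    commutes⇒principal : ClassMapCommutesWithMeets S → PrincipalFilter S
    commutes⇒principal commutes =
      Θ , Θ∈S , λ a → (λ sa → ⋀ᶠ-lower (a , sa)) , upClosed Θ∈S
      where
      Θ : Carrier
      Θ = ⋀ᶠ {Σ Carrier S} proj₁

      Θ∈S : S Θ
      Θ∈S = mp (proj₂ (commutes (Σ Carrier S) proj₁) 𝐊 λ (_ , sa) → 𝐊⊢ sa) K∈S

    -- (2) ⇒ (1): ↑Θ is generated by Θ, and Θ ≼ 𝐊 ∧ 𝐊′ = ⋔.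
    principal⇒finitelyGenerated : PrincipalFilter S → FinitelyGenerated S × S ⋔
    principal⇒finitelyGenerated (Θ , Θ∈S , ↑Θ) =
      (Θ ∷ [] , sep , (λ { (here refl) → Θ∈S }) ,
        λ S′ sep′ Θ∈S′ sa → IsSeparator.upClosed sep′ (Θ∈S′ (here refl)) (proj₁ (↑Θ _) sa)) ,
      proj₂ (↑Θ _) (∧-greatest (proj₁ (↑Θ _) K∈S) (proj₁ (↑Θ _) 𝐊′∈S))

    -- (1) ⇒ (2): the fixed point of ⋔ g, with g the meet of the generators,
    -- spans a separator ↑Θ containing the generators, hence S ⊆ ↑Θ.
    finitelyGenerated⇒principal : FinitelyGenerated S × S ⋔ → PrincipalFilter S
    finitelyGenerated⇒principal ((X , _ , X⊆S , minimal) , s⋔) =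
      Θ , Θ∈S , λ a → minimal (Θ ≼_) ↑Θ-sep Θ≼X , upClosed Θ∈S
      where
      g : Carrier
      g = generatorMeet X

      fixpoint : Σ Carrier λ Θ → S Θ × Θ ≼ ⋔ ∙ g ∙ (Θ ∙ Θ)
      fixpoint = selfApplicationFixpoint (∙-closed s⋔ (generatorMeet∈S s⋔ X X⊆S))

      Θ : Carrier
      Θ = proj₁ fixpoint

      Θ∈S : S Θ
      Θ∈S = proj₁ (proj₂ fixpoint)

      Θ≼g∧ΘΘ : Θ ≼ g ∧ (Θ ∙ Θ)
      Θ≼g∧ΘΘ = trans (proj₂ (proj₂ fixpoint)) ⋔-β

      Θ≼g : Θ ≼ g
      Θ≼g = trans Θ≼g∧ΘΘ ∧-lowerˡ

      Θ≼X : ∀ {x} → x ∈ X → Θ ≼ x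
      Θ≼X x∈ = trans Θ≼g (generatorMeet≼∈ X x∈)

      ↑Θ-sep : IsSeparator (Θ ≼_)
      ↑Θ-sep = ↑-isSeparator (trans Θ≼g (generatorMeet≼𝐊 X))
                             (trans Θ≼g (generatorMeet≼𝐒 X))
                             (trans Θ≼g∧ΘΘ ∧-lowerʳ)

proposition3p30 : ∀ {ℓ : Level} (𝒜 : ImplicativeStructure ℓ) →
    let open ImplicativeStructure 𝒜 in
    let open ImplicativeStructureDefs 𝒜 in
    ∀ (S : Carrier → Set ℓ) → IsSeparator S →
    ((FinitelyGenerated S × S ⋔) ⇔ PrincipalFilter S) ×
    (PrincipalFilter S ⇔ (QuotientComplete S × ClassMapCommutesWithMeets S))
proposition3p30 𝒜 S sep =
  mk⇔ finitelyGenerated⇒principal principal⇒finitelyGenerated ,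
  mk⇔ (λ p → let commutes = principal⇒commutes p in commutes⇒complete commutes , commutes)
      (λ (_ , commutes) → commutes⇒principal commutes)
  where open Calculus.InSeparator 𝒜 S sep
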